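{- Let $\mathcal{F}$ be a family of finite lattices that is closed under vertical sum and contains the singleton lattice. For $n\ge 1$ let $f(n)$ and $f_{\mathrm{vi}}(n)$ be the numbers of $n$-element lattices and of $n$-element vertically indecomposable lattices in $\mathcal{F}$, respectively (counted up to isomorphism). Let $N \ge 2$ be an integer and let $\underline{f}\colon \mathbb{N}^+\to\mathbb{N}^+$ be the sequence defined by $\underline{f}(1)=1$, $$\underline{f}(n) = \sum_{k=2}^{n} f_{\mathrm{vi}}(k)\,\underline{f}(n-k+1)\quad\text{for } n=2,3,\ldots,N,$$ and $$\underline{f}(n) = \sum_{k=2}^{N} f_{\mathrm{vi}}(k)\,\underline{f}(n-k+1)\quad\text{for } n\ge N+1.$$ Then $f(n)\ge \underline{f}(n)$ for all $n\ge 1$. Furthermore, the infinite sequence $\underline{f}$ is determined by $f_{\mathrm{vi}}(1),\ldots,f_{\mathrm{vi}}(N)$ through a homogeneous linear recurrence relation of order $N-1$ with constant coefficients, namely $\underline{f}(n)=\sum_{i=1}^{N-1} a_i\,\underline{f}(n-i)$ for $n\ge N+1$, where $a_i = f_{\mathrm{vi}}(i+1)$.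
   Context: All lattices are finite, nonempty and unlabeled. The vertical sum $L+U$ of lattices $L,U$ is obtained by identifying the top element of $L$ with the bottom element of $U$ (all elements of $L$ lying below all elements of $U$). A family is closed under vertical sum if $L,U\in\mathcal{F}$ implies $L+U\in\mathcal{F}$. A knot of a lattice $X$ is an element distinct from the top and bottom of $X$ that is comparable to all elements of $X$. A lattice is vertically indecomposable (a vi-lattice) if it has no knot; by convention the singleton lattice is counted as a vi-lattice. -}

module Defs where

open import Level using (0ℓ)
open import Data.Nat using (ℕ; zero; suc; _+_; _*_; _∸_; _≤_)
open import Data.Fin using (Fin)
open import Data.List using (upTo; map)
open import Data.Nat.ListAction using (sum)
open import Data.Product using (Σ; ∃; ∃-syntax; _×_)
open import Data.Sum using (_⊎_)
open import Relation.Nullary using (¬_)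
open import Relation.Binary.Core using (Rel)
open import Relation.Binary.PropositionalEquality using (_≡_; _≢_)
open import Relation.Binary.Lattice.Structures using (IsLattice)

-- A finite (nonempty) lattice, presented on the carrier Fin size.
-- Unlabeled lattices = isomorphism classes of these.

record FinLattice : Set₁ where
  field
    size      : ℕ
    nonempty  : 1 ≤ size
    _≤L_      : Rel (Fin size) 0ℓ
    _∨L_      : Fin size → Fin size → Fin size
    _∧L_      : Fin size → Fin size → Fin size
    isLattice : IsLattice _≡_ _≤L_ _∨L_ _∧L_

open FinLattice public

IsTop : (L : FinLattice) → Fin (size L) → Set
IsTop L t = ∀ x → _≤L_ L x t

IsBot : (L : FinLattice) → Fin (size L) → Set
IsBot L b = ∀ x → _≤L_ L b x

IsOrderEmbedding : (L X : FinLattice) → (Fin (size L) → Fin (size X)) → Set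
IsOrderEmbedding L X φ =
  ∀ x y → (_≤L_ L x y → _≤L_ X (φ x) (φ y)) × (_≤L_ X (φ x) (φ y) → _≤L_ L x y)

-- order isomorphism (= lattice isomorphism)
record _≅_ (L X : FinLattice) : Set where
  field
    to      : Fin (size L) → Fin (size X)
    from    : Fin (size X) → Fin (size L)
    from-to : ∀ x → from (to x) ≡ x
    to-from : ∀ y → to (from y) ≡ y
    mono    : IsOrderEmbedding L X to

-- X is (isomorphic to) the vertical sum L + U: X is covered by an order
-- embedded copy of L and an order embedded copy of U, the top of L is
-- identified with the bottom of U, and all of L lies below all of U.
IsVerticalSum : (L U X : FinLattice) → Set
IsVerticalSum L U X =
  Σ (Fin (size L) → Fin (size X)) λ i →
  Σ (Fin (size U) → Fin (size X)) λ j →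
    IsOrderEmbedding L X i
  × IsOrderEmbedding U X j
  × (∃[ t ] ∃[ b ] (IsTop L t × IsBot U b × i t ≡ j b))
  × (∀ a b → _≤L_ X (i a) (j b))
  × (∀ z → (∃[ a ] i a ≡ z) ⊎ (∃[ b ] j b ≡ z))

IsKnot : (X : FinLattice) → Fin (size X) → Set
IsKnot X c = ¬ IsTop X c × ¬ IsBot X c × (∀ x → _≤L_ X x c ⊎ _≤L_ X c x)

IsVI : FinLattice → Set
IsVI X = ¬ (∃[ c ] IsKnot X c)

-- families of (unlabeled) lattices: isomorphism-invariant predicates
IsoInvariant : (FinLattice → Set) → Set₁
IsoInvariant F = ∀ L X → L ≅ X → F L → F X

ClosedUnderVerticalSum : (FinLattice → Set) → Set₁
ClosedUnderVerticalSum F = ∀ L U X → F L → F U → IsVerticalSum L U X → F X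

ContainsSingleton : (FinLattice → Set) → Set₁
ContainsSingleton F = ∀ L → size L ≡ 1 → F L

-- "the number of n-element lattices satisfying P, up to isomorphism, is m":
-- there are m pairwise non-isomorphic such lattices, and every such lattice
-- is isomorphic to one of them.
CountUpToIso : (FinLattice → Set) → ℕ → ℕ → Set₁
CountUpToIso P n m =
  Σ (Fin m → FinLattice) λ R →
      (∀ r → size (R r) ≡ n × P (R r))
    × (∀ r s → r ≢ s → ¬ (R r ≅ R s))
    × (∀ L → size L ≡ n → P L → ∃[ r ] (L ≅ R r))

-- ∑[k = a .. b] h k  (empty, i.e. 0, when b < a)
∑[_⋯_] : ℕ → ℕ → (ℕ → ℕ) → ℕ
∑[ a ⋯ b ] h = sum (map (λ i → h (a + i)) (upTo (suc b ∸ a)))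

module Submission where

-- If V is a vi-lattice with at least two elements, then in a vertical sum V + U
-- the glued element (top of V = bottom of U) is the least "cut point": the least
-- non-bottom element comparable with everything.  Isomorphisms preserve least cut
-- points, so V + U ≅ V' + U' forces V ≅ V' and U ≅ U' (cancellation).  Hence the
-- stacks V + U, with V one of the fvi(k) vi-lattices of size k ≥ 2 in the family
-- and U one of the f(n-k+1) lattices of size n-k+1, are pairwise non-isomorphic
-- n-element members of the family, which gives the stacking bound
--   f(n) ≥ ∑_{k=2}^{n} fvi(k) · f(n-k+1)          (n ≥ 2).
-- The sequence g of the theorem satisfies the same recurrence with the sum possibly
-- truncated at N, so g(n) ≤ ∑_{k=2}^{n} fvi(k) · g(n-k+1), and strong induction
-- yields g ≤ f.  The linear recurrence of order N - 1 is the substitution k = i + 1.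

open import Defs
open import Data.Nat using (ℕ; zero; suc; _+_; _*_; _∸_; _≤_; _<_; z≤n; s≤s; >-nonZero⁻¹)
import Data.Nat.Properties as ℕP
open import Data.Nat.Induction using (<-rec)
open import Data.Nat.ListAction using (sum)
open import Data.Fin using (Fin; zero; suc; toℕ; fromℕ<; splitAt; join; punchIn; punchOut; _↑ˡ_; _↑ʳ_; remQuot; _≟_)
import Data.Fin.Properties as FinP
open import Data.List using (map; applyUpTo)
open import Data.Product using (Σ-syntax; ∃-syntax; _×_; _,_; proj₁; proj₂)
open import Data.Sum using (_⊎_; inj₁; inj₂) renaming (map to map⊎)
open import Data.Unit using (⊤; tt)
open import Data.Empty using (⊥-elim)
open import Relation.Nullary using (¬_; yes; no)
open import Relation.Nullary.Decidable using (decidable-stable)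
open import Relation.Binary.PropositionalEquality
  using (_≡_; _≢_; refl; sym; trans; cong; cong₂; subst; subst₂; isEquivalence; ≢-sym; module ≡-Reasoning)
open import Relation.Binary.Lattice.Structures using (IsLattice)
open import Function using (_∘_; id)
open import Function.Bundles using (Injection)
open import Function.Properties.Inverse using (↔⇒↣)

open _≅_ using (to; from)

module LatticeFacts (L : FinLattice) where
  open IsLattice (isLattice L) public
    using (x≤x∨y; y≤x∨y; ∨-least; x∧y≤x; x∧y≤y; ∧-greatest)
    renaming (refl to ⊑-refl; reflexive to ⊑-reflexive; trans to ⊑-trans; antisym to ⊑-antisym)

  Carrier : Set
  Carrier = Fin (size L)

  infix 4 _⊑_
  _⊑_ : Carrier → Carrier → Set
  _⊑_ = _≤L_ L

  _⊔_ _⊓_ : Carrier → Carrier → Carrier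
  _⊔_ = _∨L_ L
  _⊓_ = _∧L_ L

  -- Join and meet of a finite family; the empty family gets an arbitrary element.
  ⋁ ⋀ : ∀ {m} → (Fin m → Carrier) → Carrier
  ⋁ {zero}  _ = fromℕ< (nonempty L)
  ⋁ {suc m} x = x zero ⊔ ⋁ (x ∘ suc)
  ⋀ {zero}  _ = fromℕ< (nonempty L)
  ⋀ {suc m} x = x zero ⊓ ⋀ (x ∘ suc)

  ⋁-upper : ∀ {m} (x : Fin m → Carrier) i → x i ⊑ ⋁ x
  ⋁-upper x zero    = x≤x∨y _ _
  ⋁-upper x (suc i) = ⊑-trans (⋁-upper (x ∘ suc) i) (y≤x∨y _ _)

  ⋀-lower : ∀ {m} (x : Fin m → Carrier) i → ⋀ x ⊑ x i
  ⋀-lower x zero    = x∧y≤x _ _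
  ⋀-lower x (suc i) = ⊑-trans (x∧y≤y _ _) (⋀-lower (x ∘ suc) i)

  top bot : Carrier
  top = ⋁ id
  bot = ⋀ id

  top-max : IsTop L top
  top-max = ⋁-upper id

  bot-min : IsBot L bot
  bot-min = ⋀-lower id

  -- Top and bottom differ as soon as there are two elements: otherwise all elements coincide.
  top≢bot : 2 ≤ size L → top ≢ bot
  top≢bot 2≤size top≡bot = ℕP.<⇒≱ 2≤size (FinP.injective⇒≤ {f = λ (_ : Carrier) → zero {0}} collapse)
    where
    all-top : ∀ x → x ≡ top
    all-top x = ⊑-antisym (top-max x) (subst (_⊑ x) (sym top≡bot) (bot-min x))
    collapse : ∀ {x y} → zero ≡ zero → x ≡ y
    collapse {x} {y} _ = trans (all-top x) (sym (all-top y))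

≅-mono : ∀ {X Y} (φ : X ≅ Y) {x y} → _≤L_ X x y → _≤L_ Y (to φ x) (to φ y)
≅-mono φ {x} {y} = proj₁ (_≅_.mono φ x y)

≅-sym : ∀ {X Y} → X ≅ Y → Y ≅ X
≅-sym {Y = Y} φ = record
  { to = from φ ; from = to φ ; from-to = _≅_.to-from φ ; to-from = _≅_.from-to φ
  ; mono = λ y y' →
      (λ y≤y' → proj₂ (_≅_.mono φ (from φ y) (from φ y')) (subst₂ (_≤L_ Y) (sym (_≅_.to-from φ y)) (sym (_≅_.to-from φ y')) y≤y'))
    , (λ φy≤φy' → subst₂ (_≤L_ Y) (_≅_.to-from φ y) (_≅_.to-from φ y') (≅-mono φ φy≤φy')) }

≅-trans : ∀ {X Y Z} → X ≅ Y → Y ≅ Z → X ≅ Z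
≅-trans φ ψ = record
  { to = to ψ ∘ to φ
  ; from = from φ ∘ from ψ
  ; from-to = λ x → trans (cong (from φ) (_≅_.from-to ψ (to φ x))) (_≅_.from-to φ x)
  ; to-from = λ z → trans (cong (to ψ) (_≅_.to-from φ (from ψ z))) (_≅_.to-from ψ z)
  ; mono = λ x y → (λ x≤y → ≅-mono ψ (≅-mono φ x≤y))
                 , (λ z≤z' → proj₂ (_≅_.mono φ x y) (proj₂ (_≅_.mono ψ (to φ x) (to φ y)) z≤z')) }

≅-size : ∀ {X Y} → X ≅ Y → size X ≡ size Y
≅-size φ = ℕP.≤-antisym (FinP.injective⇒≤ (injective φ)) (FinP.injective⇒≤ (injective (≅-sym φ)))
  where
  injective : ∀ {X Y} (ψ : X ≅ Y) {x y} → to ψ x ≡ to ψ y → x ≡ y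
  injective ψ {x} {y} e = trans (sym (_≅_.from-to ψ x)) (trans (cong (from ψ) e) (_≅_.from-to ψ y))

≅-below : ∀ {X Y} (φ : X ≅ Y) {x c c'} → to φ c ≡ c' → _≤L_ X x c → _≤L_ Y (to φ x) c'
≅-below {Y = Y} φ {x} φc≡c' x≤c = subst (_≤L_ Y (to φ x)) φc≡c' (≅-mono φ x≤c)

≅-above : ∀ {X Y} (φ : X ≅ Y) {x c c'} → to φ c ≡ c' → _≤L_ X c x → _≤L_ Y c' (to φ x)
≅-above {Y = Y} φ {x} φc≡c' c≤x = subst (λ t → _≤L_ Y t (to φ x)) φc≡c' (≅-mono φ c≤x)

-- A cut point is a non-bottom element comparable with every element (a knot or the top).
IsCutPoint : (X : FinLattice) → Fin (size X) → Set
IsCutPoint X d = ¬ IsBot X d × (∀ x → _≤L_ X x d ⊎ _≤L_ X d x)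

LeastCutPoint : (X : FinLattice) → Fin (size X) → Set
LeastCutPoint X c = IsCutPoint X c × (∀ d → IsCutPoint X d → _≤L_ X c d)

≅-cutPoint : ∀ {X Y} (φ : X ≅ Y) {d} → IsCutPoint X d → IsCutPoint Y (to φ d)
≅-cutPoint {Y = Y} φ {d} (not-bot , comparable) =
    (λ φd-bot → not-bot (λ x → proj₂ (mono d x) (φd-bot (to φ x))))
  , (λ y → map⊎ (λ x≤d → subst (λ t → _≤L_ Y t (to φ d)) (to-from y) (≅-mono φ x≤d))
                (λ d≤x → subst (_≤L_ Y (to φ d)) (to-from y) (≅-mono φ d≤x))
                (comparable (from φ y)))
  where open _≅_ φ using (mono; to-from)

≅-leastCut : ∀ {X Y} (φ : X ≅ Y) {c c'} → LeastCutPoint X c → LeastCutPoint Y c' → to φ c ≡ c'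
≅-leastCut {Y = Y} φ {c} {c'} (c-cut , c-least) (c'-cut , c'-least) =
  LatticeFacts.⊑-antisym Y φc≤c' (c'-least (to φ c) (≅-cutPoint φ c-cut))
  where
  φc≤c' : _≤L_ Y (to φ c) c'
  φc≤c' = subst (_≤L_ Y (to φ c)) (_≅_.to-from φ c') (≅-mono φ (c-least (from φ c') (≅-cutPoint (≅-sym φ) c'-cut)))

-- An isomorphism X ≅ X' mapping the image of an order embedding e : V → X onto the
-- image of e' : V' → X' (images described through retractions r, r') restricts to V ≅ V'.
≅-restrict : ∀ {X X' V V'} (φ : X ≅ X')
  {e : Fin (size V) → Fin (size X)} {r : Fin (size X) → Fin (size V)}
  {e' : Fin (size V') → Fin (size X')} {r' : Fin (size X') → Fin (size V')}
  → IsOrderEmbedding V X e → IsOrderEmbedding V' X' e'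
  → (∀ v → r (e v) ≡ v) → (∀ w → r' (e' w) ≡ w)
  → (∀ v → e' (r' (to φ (e v))) ≡ to φ (e v))
  → (∀ w → e (r (from φ (e' w))) ≡ from φ (e' w))
  → V ≅ V'
≅-restrict {X' = X'} φ {e} {r} {e'} {r'} e-emb e'-emb re r'e' φe∈e' φ⁻¹e'∈e = record
  { to = λ v → r' (to φ (e v))
  ; from = λ w → r (from φ (e' w))
  ; from-to = λ v → trans (cong (r ∘ from φ) (φe∈e' v)) (trans (cong r (_≅_.from-to φ (e v))) (re v))
  ; to-from = λ w → trans (cong (r' ∘ to φ) (φ⁻¹e'∈e w)) (trans (cong r' (_≅_.to-from φ (e' w))) (r'e' w))
  ; mono = λ v w →
      (λ v≤w → proj₂ (e'-emb _ _) (subst₂ (_≤L_ X') (sym (φe∈e' v)) (sym (φe∈e' w)) (≅-mono φ (proj₁ (e-emb v w) v≤w))))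
    , (λ φv≤φw → proj₂ (e-emb v w) (proj₂ (_≅_.mono φ (e v) (e w)) (subst₂ (_≤L_ X') (φe∈e' v) (φe∈e' w) (proj₁ (e'-emb _ _) φv≤φw))))
  }

-- Fin (n ∸ 1) enumerates the elements of Fin n other than a given one.
skip : ∀ {n} → Fin n → Fin (n ∸ 1) → Fin n
skip {suc n} b = punchIn b

skip-≢ : ∀ {n} (b : Fin n) k → skip b k ≢ b
skip-≢ {suc n} b = FinP.punchInᵢ≢i b

skip-injective : ∀ {n} (b : Fin n) {k l} → skip b k ≡ skip b l → k ≡ l
skip-injective {suc n} b = FinP.punchIn-injective b _ _

unskip : ∀ {n} (b x : Fin n) → b ≢ x → Fin (n ∸ 1)
unskip {suc n} b x b≢x = punchOut b≢x

skip-unskip : ∀ {n} (b x : Fin n) (b≢x : b ≢ x) → skip b (unskip b x b≢x) ≡ x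
skip-unskip {suc n} b x = FinP.punchIn-punchOut

-- The vertical sum L + U, realised on Fin (|L| + |U| - 1): first the elements of L,
-- then those of U other than its bottom.  Each element z has coordinates
-- (lo z , hi z) in L × U, namely (x , ⊥) or (⊤ , u), and is ordered componentwise.
module VerticalSum (L U : FinLattice) where
  module Lo = LatticeFacts L
  module Up = LatticeFacts U

  Part : Set
  Part = Fin (size L) ⊎ Fin (size U ∸ 1)

  coords : Part → Fin (size L) × Fin (size U)
  coords (inj₁ x) = x , Up.bot
  coords (inj₂ k) = Lo.top , skip Up.bot k

  -- Distinct parts have distinct coordinates, since skip never hits the bottom of U.
  coords-injective : ∀ α β → coords α ≡ coords β → α ≡ β
  coords-injective (inj₁ x) (inj₁ y) e = cong (inj₁ ∘ proj₁) e
  coords-injective (inj₁ x) (inj₂ k) e = ⊥-elim (skip-≢ Up.bot k (sym (cong proj₂ e)))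
  coords-injective (inj₂ k) (inj₁ y) e = ⊥-elim (skip-≢ Up.bot k (cong proj₂ e))
  coords-injective (inj₂ k) (inj₂ l) e = cong inj₂ (skip-injective Up.bot (cong proj₂ e))

  coords-shape : ∀ α → proj₂ (coords α) ≡ Up.bot ⊎ proj₁ (coords α) ≡ Lo.top
  coords-shape (inj₁ _) = inj₁ refl
  coords-shape (inj₂ _) = inj₂ refl

  Elem : Set
  Elem = Fin (size L + (size U ∸ 1))

  part : Elem → Part
  part = splitAt (size L)

  unpart : Part → Elem
  unpart = join (size L) (size U ∸ 1)

  lo : Elem → Fin (size L)
  lo z = proj₁ (coords (part z))

  hi : Elem → Fin (size U)
  hi z = proj₂ (coords (part z))

  shape : ∀ z → hi z ≡ Up.bot ⊎ lo z ≡ Lo.top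
  shape z = coords-shape (part z)

  coord-injective : ∀ {z w} → lo z ≡ lo w → hi z ≡ hi w → z ≡ w
  coord-injective {z} {w} lo≡ hi≡ =
    Injection.injective (↔⇒↣ (FinP.+↔⊎ {size L} {size U ∸ 1})) (coords-injective (part z) (part w) (cong₂ _,_ lo≡ hi≡))

  coords-unpart : ∀ α → coords (part (unpart α)) ≡ coords α
  coords-unpart α = cong coords (FinP.splitAt-join (size L) (size U ∸ 1) α)

  infix 4 _⊑_
  _⊑_ : Elem → Elem → Set
  z ⊑ w = lo z Lo.⊑ lo w × hi z Up.⊑ hi w

  ⊑-by-coords : ∀ {z w x y u v} → lo z ≡ x → lo w ≡ y → hi z ≡ u → hi w ≡ v → x Lo.⊑ y → u Up.⊑ v → z ⊑ w
  ⊑-by-coords lo-z lo-w hi-z hi-w x⊑y u⊑v =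
    subst₂ Lo._⊑_ (sym lo-z) (sym lo-w) x⊑y , subst₂ Up._⊑_ (sym hi-z) (sym hi-w) u⊑v

  elem : Fin (size L) → Fin (size U) → Elem
  elem x u with u ≟ Up.bot
  ... | yes _   = unpart (inj₁ x)
  ... | no u≢⊥ = unpart (inj₂ (unskip Up.bot u (≢-sym u≢⊥)))

  hi-elem : ∀ x u → hi (elem x u) ≡ u
  hi-elem x u with u ≟ Up.bot
  ... | yes u≡⊥ = trans (cong proj₂ (coords-unpart (inj₁ x))) (sym u≡⊥)
  ... | no u≢⊥ = trans (cong proj₂ (coords-unpart (inj₂ _))) (skip-unskip Up.bot u _)

  LoElem : Fin (size L) → Fin (size U) → Set
  LoElem x u = (u ≡ Up.bot × lo (elem x u) ≡ x) ⊎ (u ≢ Up.bot × lo (elem x u) ≡ Lo.top)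

  lo-elem : ∀ x u → LoElem x u
  lo-elem x u with u ≟ Up.bot
  ... | yes u≡⊥ = inj₁ (u≡⊥ , cong proj₁ (coords-unpart (inj₁ x)))
  ... | no u≢⊥ = inj₂ (u≢⊥ , cong proj₁ (coords-unpart (inj₂ _)))

  lo-top : ∀ {u} z → u ≢ Up.bot → u Up.⊑ hi z → lo z ≡ Lo.top
  lo-top z u≢⊥ u⊑hi with shape z
  ... | inj₁ hi≡⊥ = ⊥-elim (u≢⊥ (Up.⊑-antisym (subst (_ Up.⊑_) hi≡⊥ u⊑hi) (Up.bot-min _)))
  ... | inj₂ lo≡⊤ = lo≡⊤

  elem-least : ∀ {x u} z → x Lo.⊑ lo z → u Up.⊑ hi z → elem x u ⊑ z
  elem-least {x} {u} z x⊑ u⊑ = lo⊑ (lo-elem x u) , subst (Up._⊑ hi z) (sym (hi-elem x u)) u⊑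
    where
    lo⊑ : LoElem x u → lo (elem x u) Lo.⊑ lo z
    lo⊑ (inj₁ (_ , lo≡x)) = subst (Lo._⊑ lo z) (sym lo≡x) x⊑
    lo⊑ (inj₂ (u≢⊥ , lo≡⊤)) = Lo.⊑-reflexive (trans lo≡⊤ (sym (lo-top z u≢⊥ u⊑)))

  elem-greatest : ∀ {x u} z → lo z Lo.⊑ x → hi z Up.⊑ u → z ⊑ elem x u
  elem-greatest {x} {u} z ⊑x ⊑u = ⊑lo (lo-elem x u) , subst (hi z Up.⊑_) (sym (hi-elem x u)) ⊑u
    where
    ⊑lo : LoElem x u → lo z Lo.⊑ lo (elem x u)
    ⊑lo (inj₁ (_ , lo≡x)) = subst (lo z Lo.⊑_) (sym lo≡x) ⊑x
    ⊑lo (inj₂ (_ , lo≡⊤)) = subst (lo z Lo.⊑_) (sym lo≡⊤) (Lo.top-max _)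

  _⊔_ _⊓_ : Elem → Elem → Elem
  z ⊔ w = elem (lo z Lo.⊔ lo w) (hi z Up.⊔ hi w)
  z ⊓ w = elem (lo z Lo.⊓ lo w) (hi z Up.⊓ hi w)

  isLattice′ : IsLattice _≡_ _⊑_ _⊔_ _⊓_
  isLattice′ = record
    { isPartialOrder = record
      { isPreorder = record
        { isEquivalence = isEquivalence
        ; reflexive = λ { refl → Lo.⊑-refl , Up.⊑-refl }
        ; trans = λ (p , q) (p' , q') → Lo.⊑-trans p p' , Up.⊑-trans q q' }
      ; antisym = λ (p , q) (p' , q') → coord-injective (Lo.⊑-antisym p p') (Up.⊑-antisym q q') }
    ; supremum = λ z w → elem-greatest z (Lo.x≤x∨y _ _) (Up.x≤x∨y _ _)
                       , elem-greatest w (Lo.y≤x∨y _ _) (Up.y≤x∨y _ _)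
                       , λ v (p , q) (p' , q') → elem-least v (Lo.∨-least p p') (Up.∨-least q q')
    ; infimum = λ z w → elem-least z (Lo.x∧y≤x _ _) (Up.x∧y≤x _ _)
                      , elem-least w (Lo.x∧y≤y _ _) (Up.x∧y≤y _ _)
                      , λ v (p , q) (p' , q') → elem-greatest v (Lo.∧-greatest p p') (Up.∧-greatest q q')
    }

  vsum : FinLattice
  vsum = record
    { size = size L + (size U ∸ 1)
    ; nonempty = ℕP.≤-trans (nonempty L) (ℕP.m≤m+n _ _)
    ; _≤L_ = _⊑_ ; _∨L_ = _⊔_ ; _∧L_ = _⊓_
    ; isLattice = isLattice′
    }

  inL : Fin (size L) → Elem
  inL x = elem x Up.bot

  inU : Fin (size U) → Elem
  inU u = elem Lo.top u

  lo-inL : ∀ x → lo (inL x) ≡ x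
  lo-inL x with lo-elem x Up.bot
  ... | inj₁ (_ , lo≡x) = lo≡x
  ... | inj₂ (⊥≢⊥ , _) = ⊥-elim (⊥≢⊥ refl)

  hi-inL : ∀ x → hi (inL x) ≡ Up.bot
  hi-inL x = hi-elem x Up.bot

  lo-inU : ∀ u → lo (inU u) ≡ Lo.top
  lo-inU u with lo-elem Lo.top u
  ... | inj₁ (_ , lo≡⊤) = lo≡⊤
  ... | inj₂ (_ , lo≡⊤) = lo≡⊤

  hi-inU : ∀ u → hi (inU u) ≡ u
  hi-inU u = hi-elem Lo.top u

  inL-emb : IsOrderEmbedding L vsum inL
  inL-emb x y = (λ x⊑y → ⊑-by-coords (lo-inL x) (lo-inL y) (hi-inL x) (hi-inL y) x⊑y Up.⊑-refl)
              , (λ (p , _) → subst₂ Lo._⊑_ (lo-inL x) (lo-inL y) p)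

  inU-emb : IsOrderEmbedding U vsum inU
  inU-emb u v = (λ u⊑v → ⊑-by-coords (lo-inU u) (lo-inU v) (hi-inU u) (hi-inU v) Lo.⊑-refl u⊑v)
              , (λ (_ , q) → subst₂ Up._⊑_ (hi-inU u) (hi-inU v) q)

  inL⊑inU : ∀ x u → inL x ⊑ inU u
  inL⊑inU x u = ⊑-by-coords (lo-inL x) (lo-inU u) (hi-inL x) (hi-inU u) (Lo.top-max x) (Up.bot-min u)

  cover : ∀ z → (∃[ x ] inL x ≡ z) ⊎ (∃[ u ] inU u ≡ z)
  cover z with shape z
  ... | inj₁ hi≡⊥ = inj₁ (lo z , coord-injective (lo-inL _) (trans (hi-inL _) (sym hi≡⊥)))
  ... | inj₂ lo≡⊤ = inj₂ (hi z , coord-injective (trans (lo-inU (hi z)) (sym lo≡⊤)) (hi-inU _))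

  isVerticalSum : IsVerticalSum L U vsum
  isVerticalSum = inL , inU , inL-emb , inU-emb , (Lo.top , Up.bot , Lo.top-max , Up.bot-min , refl) , inL⊑inU , cover

  glue : Elem
  glue = inL Lo.top

  inL-bot : ∀ {v} → IsBot L v → IsBot vsum (inL v)
  inL-bot {v} v-min z with cover z
  ... | inj₁ (x , refl) = proj₁ (inL-emb v x) (v-min x)
  ... | inj₂ (u , refl) = inL⊑inU v u

  glue-cut : 2 ≤ size L → IsCutPoint vsum glue
  glue-cut 2≤size = not-bot , comparable
    where
    not-bot : ¬ IsBot vsum glue
    not-bot glue-min = Lo.top≢bot 2≤size (Lo.⊑-antisym (proj₂ (inL-emb Lo.top Lo.bot) (glue-min (inL Lo.bot))) (Lo.bot-min _))
    comparable : ∀ z → z ⊑ glue ⊎ glue ⊑ z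
    comparable z with cover z
    ... | inj₁ (x , refl) = inj₁ (proj₁ (inL-emb x Lo.top) (Lo.top-max x))
    ... | inj₂ (u , refl) = inj₂ (inL⊑inU Lo.top u)

  -- If L has no knot, a cut point of L + U below the glue point would be a knot of L.
  glue-least : IsVI L → ∀ d → IsCutPoint vsum d → glue ⊑ d
  glue-least vi d (not-bot , comparable) with cover d
  ... | inj₂ (u , refl) = inL⊑inU Lo.top u
  ... | inj₁ (v , refl) with v ≟ Lo.top
  ...   | yes refl = Lo.⊑-refl , Up.⊑-refl
  ...   | no v≢⊤ = ⊥-elim (vi (v , v-knot))
    where
    v-knot : IsKnot L v
    v-knot = (λ v-max → v≢⊤ (Lo.⊑-antisym (Lo.top-max v) (v-max Lo.top)))
           , (λ v-min → not-bot (inL-bot v-min))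
           , (λ w → map⊎ (proj₂ (inL-emb w v)) (proj₂ (inL-emb v w)) (comparable (inL w)))

  glue-leastCut : IsVI L → 2 ≤ size L → LeastCutPoint vsum glue
  glue-leastCut vi 2≤size = glue-cut 2≤size , glue-least vi

  down-glue : ∀ z → z ⊑ glue → inL (lo z) ≡ z
  down-glue z (_ , hi⊑) = coord-injective (lo-inL _)
    (trans (hi-inL _) (Up.⊑-antisym (Up.bot-min _) (subst (hi z Up.⊑_) (hi-inL Lo.top) hi⊑)))

  up-glue : ∀ z → glue ⊑ z → inU (hi z) ≡ z
  up-glue z (lo⊑ , _) = coord-injective
    (trans (lo-inU (hi z)) (Lo.⊑-antisym (subst (Lo._⊑ lo z) (lo-inL Lo.top) lo⊑) (Lo.top-max _)))
    (hi-inU _)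

  inL⊑glue : ∀ x → inL x ⊑ glue
  inL⊑glue x = proj₁ (inL-emb x Lo.top) (Lo.top-max x)

  glue⊑inU : ∀ u → glue ⊑ inU u
  glue⊑inU = inL⊑inU Lo.top

infixl 25 _+ᵛ_
_+ᵛ_ : FinLattice → FinLattice → FinLattice
L +ᵛ U = VerticalSum.vsum L U

+ᵛ-cancel : ∀ {V U V' U'} → IsVI V → IsVI V' → 2 ≤ size V → 2 ≤ size V'
          → V +ᵛ U ≅ V' +ᵛ U' → (V ≅ V') × (U ≅ U')
+ᵛ-cancel {V} {U} {V'} {U'} vi vi' 2≤V 2≤V' φ =
    ≅-restrict φ {r = A.lo} {r' = B.lo} A.inL-emb B.inL-emb A.lo-inL B.lo-inL
      (λ v → B.down-glue _ (≅-below φ glue↦glue (A.inL⊑glue v)))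
      (λ w → A.down-glue _ (≅-below (≅-sym φ) glue↤glue (B.inL⊑glue w)))
  , ≅-restrict φ {r = A.hi} {r' = B.hi} A.inU-emb B.inU-emb A.hi-inU B.hi-inU
      (λ u → B.up-glue _ (≅-above φ glue↦glue (A.glue⊑inU u)))
      (λ w → A.up-glue _ (≅-above (≅-sym φ) glue↤glue (B.glue⊑inU w)))
  where
  module A = VerticalSum V U
  module B = VerticalSum V' U'
  glue↦glue : to φ A.glue ≡ B.glue
  glue↦glue = ≅-leastCut φ (A.glue-leastCut vi 2≤V) (B.glue-leastCut vi' 2≤V')
  glue↤glue : from φ B.glue ≡ A.glue
  glue↤glue = ≅-leastCut (≅-sym φ) (B.glue-leastCut vi' 2≤V') (A.glue-leastCut vi 2≤V)

module Representatives {P : FinLattice → Set} {n m : ℕ} (counted : CountUpToIso P n m) where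
  rep : Fin m → FinLattice
  rep = proj₁ counted

  rep-size : ∀ r → size (rep r) ≡ n
  rep-size r = proj₁ (proj₁ (proj₂ counted) r)

  rep-P : ∀ r → P (rep r)
  rep-P r = proj₂ (proj₁ (proj₂ counted) r)

  rep-injective : ∀ {r s} → rep r ≅ rep s → r ≡ s
  rep-injective {r} {s} φ = decidable-stable (r ≟ s) (λ r≢s → proj₁ (proj₂ (proj₂ counted)) r s r≢s φ)

  classify : ∀ L → size L ≡ n → P L → Fin m
  classify L size≡n p = proj₁ (proj₂ (proj₂ (proj₂ counted)) L size≡n p)

  classify-≅ : ∀ L size≡n p → L ≅ rep (classify L size≡n p)
  classify-≅ L size≡n p = proj₂ (proj₂ (proj₂ (proj₂ counted)) L size≡n p)

  positive : ∀ L → size L ≡ n → P L → 1 ≤ m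
  positive L size≡n p = >-nonZero⁻¹ m {{FinP.nonZeroIndex (classify L size≡n p)}}

  bound : ∀ {k} (Q : Fin k → FinLattice) → (∀ q → size (Q q) ≡ n) → (∀ q → P (Q q))
        → (∀ {q q'} → Q q ≅ Q q' → q ≡ q') → k ≤ m
  bound {k} Q Q-size Q-P Q-injective = FinP.injective⇒≤ {f = class} class-injective
    where
    class : Fin k → Fin m
    class q = classify (Q q) (Q-size q) (Q-P q)
    class-injective : ∀ {q q'} → class q ≡ class q' → q ≡ q'
    class-injective {q} {q'} same = Q-injective (≅-trans (classify-≅ _ _ _)
      (subst (λ c → rep c ≅ Q q') (sym same) (≅-sym (classify-≅ _ _ _))))

∑< : ℕ → (ℕ → ℕ) → ℕ
∑< zero    h = 0
∑< (suc m) h = h 0 + ∑< m (h ∘ suc)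

sum-applyUpTo : ∀ (h g : ℕ → ℕ) m → sum (map h (applyUpTo g m)) ≡ ∑< m (h ∘ g)
sum-applyUpTo h g zero    = refl
sum-applyUpTo h g (suc m) = cong (h (g 0) +_) (sum-applyUpTo h (g ∘ suc) m)

∑-as-∑< : ∀ a b h → ∑[ a ⋯ b ] h ≡ ∑< (suc b ∸ a) (λ i → h (a + i))
∑-as-∑< a b h = sum-applyUpTo (λ i → h (a + i)) id (suc b ∸ a)

∑<-mono : ∀ m {h h'} → (∀ i → i < m → h i ≤ h' i) → ∑< m h ≤ ∑< m h'
∑<-mono zero    h≤h' = z≤n
∑<-mono (suc m) h≤h' = ℕP.+-mono-≤ (h≤h' 0 (s≤s z≤n)) (∑<-mono m (λ i i<m → h≤h' (suc i) (s≤s i<m)))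

∑<-extend : ∀ {m m'} h → m ≤ m' → ∑< m h ≤ ∑< m' h
∑<-extend h z≤n       = z≤n
∑<-extend h (s≤s m≤m') = ℕP.+-monoʳ-≤ (h 0) (∑<-extend (h ∘ suc) m≤m')

in-range : ∀ a b i → i < suc b ∸ a → a + i ≤ b
in-range zero          b       i i<1+b = ℕP.≤-pred i<1+b
in-range (suc zero)    zero    i ()
in-range (suc (suc a)) zero    i ()
in-range (suc a)       (suc b) i i<    = s≤s (in-range a b i i<)

∑-mono : ∀ a b {h h'} → (∀ k → a ≤ k → k ≤ b → h k ≤ h' k) → ∑[ a ⋯ b ] h ≤ ∑[ a ⋯ b ] h'
∑-mono a b {h} {h'} h≤h' = begin
  ∑[ a ⋯ b ] h                       ≡⟨ ∑-as-∑< a b h ⟩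
  ∑< (suc b ∸ a) (λ i → h (a + i))   ≤⟨ ∑<-mono (suc b ∸ a) (λ i i< → h≤h' (a + i) (ℕP.m≤m+n a i) (in-range a b i i<)) ⟩
  ∑< (suc b ∸ a) (λ i → h' (a + i))  ≡⟨ sym (∑-as-∑< a b h') ⟩
  ∑[ a ⋯ b ] h'                      ∎
  where open ℕP.≤-Reasoning

∑-cong : ∀ a b {h h'} → (∀ k → a ≤ k → k ≤ b → h k ≡ h' k) → ∑[ a ⋯ b ] h ≡ ∑[ a ⋯ b ] h'
∑-cong a b h≡h' = ℕP.≤-antisym (∑-mono a b (λ k a≤k k≤b → ℕP.≤-reflexive (h≡h' k a≤k k≤b)))
                               (∑-mono a b (λ k a≤k k≤b → ℕP.≤-reflexive (sym (h≡h' k a≤k k≤b))))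

∑-extend : ∀ a {b b'} h → b ≤ b' → ∑[ a ⋯ b ] h ≤ ∑[ a ⋯ b' ] h
∑-extend a {b} {b'} h b≤b' = begin
  ∑[ a ⋯ b ] h                        ≡⟨ ∑-as-∑< a b h ⟩
  ∑< (suc b ∸ a) (λ i → h (a + i))    ≤⟨ ∑<-extend (λ i → h (a + i)) (ℕP.∸-monoˡ-≤ a (s≤s b≤b')) ⟩
  ∑< (suc b' ∸ a) (λ i → h (a + i))   ≡⟨ sym (∑-as-∑< a b' h) ⟩
  ∑[ a ⋯ b' ] h                       ∎
  where open ℕP.≤-Reasoning

Σ-≡-by : ∀ {A : Set} {B : A → Set} (R : ∀ {a a'} → B a → B a' → Set)
       → (∀ {a} {b b' : B a} → R b b' → b ≡ b')
       → ∀ {a a' b b'} → a ≡ a' → R {a} {a'} b b' → (a , b) ≡ (a' , b')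
Σ-≡-by R R-fibre refl r = cong (_ ,_) (R-fibre r)

∑<-split : ∀ m h → Fin (∑< m h) → Σ[ i ∈ Fin m ] Fin (h (toℕ i))
∑<-split (suc m) h z with splitAt (h 0) z
... | inj₁ x = zero , x
... | inj₂ y with ∑<-split m (h ∘ suc) y
...   | i , w = suc i , w

∑<-join : ∀ m h → Σ[ i ∈ Fin m ] Fin (h (toℕ i)) → Fin (∑< m h)
∑<-join (suc m) h (zero , x)  = x ↑ˡ ∑< m (h ∘ suc)
∑<-join (suc m) h (suc i , w) = h 0 ↑ʳ ∑<-join m (h ∘ suc) (i , w)

∑<-join-split : ∀ m h z → ∑<-join m h (∑<-split m h z) ≡ z
∑<-join-split (suc m) h z with splitAt (h 0) z in eq
... | inj₁ x = trans (cong (join (h 0) _) (sym eq)) (FinP.join-splitAt (h 0) _ z)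
... | inj₂ y = trans (cong (h 0 ↑ʳ_) (∑<-join-split m (h ∘ suc) y))
                     (trans (cong (join (h 0) _) (sym eq)) (FinP.join-splitAt (h 0) _ z))

∑<-split-injective : ∀ m h {z z'} → ∑<-split m h z ≡ ∑<-split m h z' → z ≡ z'
∑<-split-injective m h {z} {z'} same =
  trans (sym (∑<-join-split m h z)) (trans (cong (∑<-join m h) same) (∑<-join-split m h z'))

module Stacking (F : FinLattice → Set) (closed : ClosedUnderVerticalSum F) (f fvi : ℕ → ℕ)
  (count : ∀ n → 1 ≤ n → CountUpToIso F n (f n))
  (countVI : ∀ n → 1 ≤ n → CountUpToIso (λ L → F L × IsVI L) n (fvi n)) where

  module VIs (i : ℕ) = Representatives (countVI (2 + i) (s≤s z≤n))
  module All (m : ℕ) = Representatives (count (m + 1) (ℕP.m≤n+m 1 m))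

  -- The stacks of total size n whose lower summand has 2 + i elements, indexed by
  -- pairs (lower summand, upper summand).
  stacks : ℕ → ℕ → ℕ
  stacks n i = fvi (2 + i) * f (n ∸ (2 + i) + 1)

  lower upper stack : ∀ n i → Fin (stacks n i) → FinLattice
  lower n i z = VIs.rep i (proj₁ (remQuot {fvi (2 + i)} (f (n ∸ (2 + i) + 1)) z))
  upper n i z = All.rep (n ∸ (2 + i)) (proj₂ (remQuot {fvi (2 + i)} (f (n ∸ (2 + i) + 1)) z))
  stack n i z = lower n i z +ᵛ upper n i z

  lower-size : ∀ n i z → size (lower n i z) ≡ 2 + i
  lower-size n i z = VIs.rep-size i _

  stack-size : ∀ n i z → 2 + i ≤ n → size (stack n i z) ≡ n
  stack-size n i z 2+i≤n = begin
    size (lower n i z) + (size (upper n i z) ∸ 1)  ≡⟨ cong₂ (λ a b → a + (b ∸ 1)) (lower-size n i z) (All.rep-size (n ∸ (2 + i)) _) ⟩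
    (2 + i) + (n ∸ (2 + i) + 1 ∸ 1)                 ≡⟨ cong ((2 + i) +_) (ℕP.m+n∸n≡m (n ∸ (2 + i)) 1) ⟩
    (2 + i) + (n ∸ (2 + i))                         ≡⟨ ℕP.m+[n∸m]≡n 2+i≤n ⟩
    n                                               ∎
    where open ≡-Reasoning

  stack-F : ∀ n i z → F (stack n i z)
  stack-F n i z = closed _ _ _ (proj₁ (VIs.rep-P i _)) (All.rep-P _ _) (VerticalSum.isVerticalSum _ _)

  stack-cancel : ∀ {n i i' z z'} → stack n i z ≅ stack n i' z' → (lower n i z ≅ lower n i' z') × (upper n i z ≅ upper n i' z')
  stack-cancel {n} {i} {i'} {z} {z'} =
    +ᵛ-cancel (proj₂ (VIs.rep-P i _)) (proj₂ (VIs.rep-P i' _)) (two≤ i z) (two≤ i' z')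
    where
    two≤ : ∀ j w → 2 ≤ size (lower n j w)
    two≤ j w = subst (2 ≤_) (sym (lower-size n j w)) (ℕP.m≤m+n 2 j)

  -- Within one lower size, a stack determines both summands and hence its index.
  stack-injective : ∀ {n i z z'} → stack n i z ≅ stack n i z' → z ≡ z'
  stack-injective {n} {i} {z} {z'} φ = remQuot-injective (cong₂ _,_ same-lower same-upper)
    where
    k : ℕ
    k = f (n ∸ (2 + i) + 1)
    same-lower : proj₁ (remQuot {fvi (2 + i)} k z) ≡ proj₁ (remQuot {fvi (2 + i)} k z')
    same-lower = VIs.rep-injective i (proj₁ (stack-cancel {n} {i} {i} {z} {z'} φ))
    same-upper : proj₂ (remQuot {fvi (2 + i)} k z) ≡ proj₂ (remQuot {fvi (2 + i)} k z')
    same-upper = All.rep-injective (n ∸ (2 + i)) (proj₂ (stack-cancel {n} {i} {i} {z} {z'} φ))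
    remQuot-injective : remQuot {fvi (2 + i)} k z ≡ remQuot k z' → z ≡ z'
    remQuot-injective = Injection.injective (↔⇒↣ (FinP.*↔× {fvi (2 + i)} {k}))

  -- All stacks of total size n, indexed by the lower size 2 + i (i < n - 1) and the summands.
  Stack : ℕ → Set
  Stack n = Σ[ i ∈ Fin (n ∸ 1) ] Fin (stacks n (toℕ i))

  stackAt : ∀ n → Stack n → FinLattice
  stackAt n s = stack n (toℕ (proj₁ s)) (proj₂ s)

  -- Stacks with different lower sizes are distinguished by the size of the lower summand.
  stackAt-injective : ∀ {n} {s s' : Stack n} → stackAt n s ≅ stackAt n s' → s ≡ s'
  stackAt-injective {n} {i , z} {i' , z'} φ =
    Σ-≡-by (λ {j} {j'} w w' → stackAt n (j , w) ≅ stackAt n (j' , w')) (stack-injective {n}) (FinP.toℕ-injective same-lower-size) φ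
    where
    same-lower-size : toℕ i ≡ toℕ i'
    same-lower-size = ℕP.+-cancelˡ-≡ 2 _ _
      (trans (sym (lower-size n (toℕ i) z)) (trans (≅-size (proj₁ (stack-cancel {n} {toℕ i} {toℕ i'} {z} {z'} φ))) (lower-size n (toℕ i') z')))

  fits : ∀ {i n} → i < n ∸ 1 → 2 + i ≤ n
  fits {n = suc n} i<n = s≤s i<n

  -- The stacks of total size n, enumerated by Fin (∑< (n ∸ 1) (stacks n)), are pairwise
  -- non-isomorphic n-element members of F, so there are at most f n of them.
  stacking-bound : ∀ n → 2 ≤ n → ∑[ 2 ⋯ n ] (λ k → fvi k * f (n ∸ k + 1)) ≤ f n
  stacking-bound n 2≤n = begin
    ∑[ 2 ⋯ n ] (λ k → fvi k * f (n ∸ k + 1))  ≡⟨ ∑-as-∑< 2 n (λ k → fvi k * f (n ∸ k + 1)) ⟩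
    ∑< (n ∸ 1) (stacks n)                      ≤⟨ Representatives.bound (count n (ℕP.≤-trans (s≤s z≤n) 2≤n))
                                                    family family-size family-F family-injective ⟩
    f n                                        ∎
    where
    open ℕP.≤-Reasoning
    split : Fin (∑< (n ∸ 1) (stacks n)) → Stack n
    split = ∑<-split (n ∸ 1) (stacks n)
    family : Fin (∑< (n ∸ 1) (stacks n)) → FinLattice
    family q = stackAt n (split q)
    family-size : ∀ q → size (family q) ≡ n
    family-size q = stack-size n (toℕ (proj₁ (split q))) (proj₂ (split q)) (fits (FinP.toℕ<n (proj₁ (split q))))
    family-F : ∀ q → F (family q)
    family-F q = stack-F n (toℕ (proj₁ (split q))) (proj₂ (split q))
    family-injective : ∀ {q q'} → family q ≅ family q' → q ≡ q'
    family-injective {q} {q'} φ = ∑<-split-injective (n ∸ 1) (stacks n) (stackAt-injective {n} {split q} {split q'} φ)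

shrink : ∀ n k → 2 ≤ k → 2 + n ∸ k + 1 < 2 + n
shrink n zero          ()
shrink n (suc zero)    (s≤s ())
shrink n (suc (suc k)) _ = s≤s (subst (_≤ suc n) (ℕP.+-comm 1 (n ∸ k)) (s≤s (ℕP.m∸n≤m n k)))

domination : ∀ (a f g : ℕ → ℕ) → g 1 ≤ f 1
  → (∀ n → 2 ≤ n → ∑[ 2 ⋯ n ] (λ k → a k * f (n ∸ k + 1)) ≤ f n)
  → (∀ n → 2 ≤ n → g n ≤ ∑[ 2 ⋯ n ] (λ k → a k * g (n ∸ k + 1)))
  → ∀ n → 1 ≤ n → g n ≤ f n
domination a f g g1≤f1 f-super g-sub = <-rec (λ n → 1 ≤ n → g n ≤ f n) step
  where
  open ℕP.≤-Reasoning
  step : ∀ n → (∀ {m} → m < n → 1 ≤ m → g m ≤ f m) → 1 ≤ n → g n ≤ f n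
  step (suc zero)    _  _ = g1≤f1
  step (suc (suc n)) IH _ = begin
    g (2 + n)                                        ≤⟨ g-sub (2 + n) 2≤2+n ⟩
    ∑[ 2 ⋯ 2 + n ] (λ k → a k * g (2 + n ∸ k + 1))  ≤⟨ ∑-mono 2 (2 + n) (λ k 2≤k _ →
                                                         ℕP.*-monoʳ-≤ (a k) (IH (shrink n k 2≤k) (ℕP.m≤n+m 1 _))) ⟩
    ∑[ 2 ⋯ 2 + n ] (λ k → a k * f (2 + n ∸ k + 1))  ≤⟨ f-super (2 + n) 2≤2+n ⟩
    f (2 + n)                                        ∎
    where
    2≤2+n : 2 ≤ 2 + n
    2≤2+n = ℕP.m≤m+n 2 n

truncated≤full : ∀ (a g : ℕ → ℕ) N
  → (∀ n → 2 ≤ n → n ≤ N → g n ≡ ∑[ 2 ⋯ n ] (λ k → a k * g (n ∸ k + 1)))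
  → (∀ n → N + 1 ≤ n → g n ≡ ∑[ 2 ⋯ N ] (λ k → a k * g (n ∸ k + 1)))
  → ∀ n → 2 ≤ n → g n ≤ ∑[ 2 ⋯ n ] (λ k → a k * g (n ∸ k + 1))
truncated≤full a g N g-small g-large n 2≤n with n ℕP.≤? N
... | yes n≤N = ℕP.≤-reflexive (g-small n 2≤n n≤N)
... | no n≰N = begin
  g n                                         ≡⟨ g-large n (subst (_≤ n) (ℕP.+-comm 1 N) N<n) ⟩
  ∑[ 2 ⋯ N ] (λ k → a k * g (n ∸ k + 1))      ≤⟨ ∑-extend 2 (λ k → a k * g (n ∸ k + 1)) (ℕP.<⇒≤ N<n) ⟩
  ∑[ 2 ⋯ n ] (λ k → a k * g (n ∸ k + 1))      ∎
  where
  open ℕP.≤-Reasoning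
  N<n : N < n
  N<n = ℕP.≰⇒> n≰N

∸-suc-+1 : ∀ n i → suc i ≤ n → n ∸ suc i + 1 ≡ n ∸ i
∸-suc-+1 n i i<n = begin
  n ∸ suc i + 1   ≡⟨ sym (ℕP.+-∸-comm 1 i<n) ⟩
  n + 1 ∸ suc i   ≡⟨ cong (_∸ suc i) (ℕP.+-comm n 1) ⟩
  n ∸ i           ∎
  where open ≡-Reasoning

reindex : ∀ (a g : ℕ → ℕ) N n → N + 1 ≤ n
        → ∑[ 2 ⋯ N ] (λ k → a k * g (n ∸ k + 1)) ≡ ∑[ 1 ⋯ N ∸ 1 ] (λ i → a (i + 1) * g (n ∸ i))
reindex a g zero    n _       = refl
reindex a g (suc N) n N+2≤n = ∑-cong 1 N (λ i _ i≤N →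
  cong₂ _*_ (cong a (ℕP.+-comm 1 i))
            (cong g (∸-suc-+1 n i (ℕP.≤-trans (s≤s i≤N) (ℕP.≤-trans (ℕP.m≤m+n (suc N) 1) N+2≤n)))))

𝟙 : FinLattice
𝟙 = record
  { size = 1 ; nonempty = s≤s z≤n
  ; _≤L_ = λ _ _ → ⊤ ; _∨L_ = λ _ _ → zero ; _∧L_ = λ _ _ → zero
  ; isLattice = record
    { isPartialOrder = record
      { isPreorder = record { isEquivalence = isEquivalence ; reflexive = λ _ → tt ; trans = λ _ _ → tt }
      ; antisym = λ {x} {y} _ _ → unique x y }
    ; supremum = λ _ _ → tt , tt , λ _ _ _ → tt
    ; infimum = λ _ _ → tt , tt , λ _ _ _ → tt } }
  where
  unique : (x y : Fin 1) → x ≡ y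
  unique zero zero = refl

theorem5 : (F : FinLattice → Set) → IsoInvariant F → ClosedUnderVerticalSum F
         → ContainsSingleton F
         → (f fvi : ℕ → ℕ)
         → (∀ n → 1 ≤ n → CountUpToIso F n (f n))
         → (∀ n → 1 ≤ n → CountUpToIso (λ L → F L × IsVI L) n (fvi n))
         → (N : ℕ) → 2 ≤ N
         → (g : ℕ → ℕ)
         → g 1 ≡ 1
         → (∀ n → 2 ≤ n → n ≤ N → g n ≡ ∑[ 2 ⋯ n ] (λ k → fvi k * g (n ∸ k + 1)))
         → (∀ n → N + 1 ≤ n → g n ≡ ∑[ 2 ⋯ N ] (λ k → fvi k * g (n ∸ k + 1)))
         → (∀ n → 1 ≤ n → g n ≤ f n)
           × (∀ n → N + 1 ≤ n → g n ≡ ∑[ 1 ⋯ N ∸ 1 ] (λ i → fvi (i + 1) * g (n ∸ i)))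
theorem5 F _ closed has-𝟙 f fvi count countVI N _ g g1≡1 g-small g-large =
    domination fvi f g g1≤f1 stacking-bound (truncated≤full fvi g N g-small g-large)
  , λ n N+1≤n → trans (g-large n N+1≤n) (reindex fvi g N n N+1≤n)
  where
  open Stacking F closed f fvi count countVI using (stacking-bound)
  -- The one-element lattice is in F, so f(1) ≥ 1 = g(1).
  g1≤f1 : g 1 ≤ f 1
  g1≤f1 = subst (_≤ f 1) (sym g1≡1) (Representatives.positive (count 1 (s≤s z≤n)) 𝟙 refl (has-𝟙 𝟙 refl))
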